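{- For all terms $t,s$: $t \approx_{\mathrm{nf}} s$ if and only if there exists a natural number $n > \max(\mathrm{fv}(t)\cup\mathrm{fv}(s))$ such that $\langle t,[\,],n\rangle_{\mathsf{ev}} \approx_{\mathrm{m}} \langle s,[\,],n\rangle_{\mathsf{ev}}$.
   Context: Terms are $t,s ::= f \mid x \mid \lambda x.t \mid t\,s$, where $f$ ranges over free variables, which are natural numbers, and $x$ over bound variables; terms are well formed (every $x$ is bound). $\mathrm{fv}(t)$ is the set of free variables of $t$. A variable $f$ is fresh if it occurs in none of the entities under consideration. Stacks are $\pi ::= t::\pi \mid [\,]$. KAM: $\langle t\,s,\pi\rangle\to\langle t,s::\pi\rangle$ and $\langle\lambda x.t,s::\pi\rangle\to\langle t\{s/x\},\pi\rangle$. Normal-form bisimilarity. A relation $\mathcal{R}$ on terms is lifted to stacks: $\pi_1\,\mathcal{R}\,\pi_2$ if $\pi_1=\pi_2=[\,]$, or $\pi_1=t::\pi_1'$, $\pi_2=s::\pi_2'$, $t\,\mathcal{R}\,s$ and $\pi_1'\,\mathcal{R}\,\pi_2'$. A symmetric relation $\mathcal{R}$ on terms is a normal-form bisimulation if $t\,\mathcal{R}\,s$ implies: (1) if $\langle t,[\,]\rangle\to^*\langle\lambda x.t',[\,]\rangle$ then there is $s'$ with $\langle s,[\,]\rangle\to^*\langle\lambda x.s',[\,]\rangle$ and $t'\{f/x\}\,\mathcal{R}\,s'\{f/x\}$ for a fresh $f$; (2) if $\langle t,[\,]\rangle\to^*\langle f,\pi\rangle$ then there is $\pi'$ with $\langle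 s,[\,]\rangle\to^*\langle f,\pi'\rangle$ and $\pi\,\mathcal{R}\,\pi'$. $\approx_{\mathrm{nf}}$ is the largest normal-form bisimulation. NFB machine: configurations $\langle t,\pi,n\rangle_{\mathsf{ev}}$ and $\langle \pi,n\rangle_{\mathsf{cont}}$ ($n\in\mathbb{N}$). Transitions: $\langle t\,s,\pi,n\rangle_{\mathsf{ev}}\xrightarrow{\tau}\langle t,s::\pi,n\rangle_{\mathsf{ev}}$; $\langle\lambda x.t,s::\pi,n\rangle_{\mathsf{ev}}\xrightarrow{\tau}\langle t\{s/x\},\pi,n\rangle_{\mathsf{ev}}$; $\langle\lambda x.t,[\,],n\rangle_{\mathsf{ev}}\xrightarrow{\lambda}\langle t\{n/x\},[\,],n+1\rangle_{\mathsf{ev}}$; $\langle f,\pi,n\rangle_{\mathsf{ev}}\xrightarrow{f}\langle\pi,n\rangle_{\mathsf{cont}}$ (the flag is the variable $f$ itself); $\langle[\,],n\rangle_{\mathsf{cont}}\xrightarrow{\mathsf{done}}$ (terminating transition, leading to no configuration); $\langle t::\pi,n\rangle_{\mathsf{cont}}\xrightarrow{\mathsf{enter}}\langle t,[\,],n\rangle_{\mathsf{ev}}$; $\langle t::\pi,n\rangle_{\mathsf{cont}}\xrightarrow{\mathsf{skip}}\langle\pi,n\rangle_{\mathsf{cont}}$. Machine bisimilarity. With $F$ ranging over flags (non-$\tau$ labels), a symmetric relation $\mathcal{R}$ on configurations is a machine bisimulation if $C_1\,\mathcal{R}\,C_2$ implies: (1) if $C_1\xrightarrow{\tau}^*\xrightarrow{F}C_1'$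 then there is $C_2'$ with $C_2\xrightarrow{\tau}^*\xrightarrow{F}C_2'$ and $C_1'\,\mathcal{R}\,C_2'$; (2) if $C_1\xrightarrow{\tau}^*\xrightarrow{F}$ by a terminating transition then $C_2\xrightarrow{\tau}^*\xrightarrow{F}$ by a terminating transition. $\approx_{\mathrm{m}}$ is the largest machine bisimulation. -}

module Defs where

open import Data.Nat using (ℕ; zero; suc; _<_)
open import Data.Fin using (Fin; zero; suc; inject₁)
open import Data.List using (List; []; _∷_)
open import Data.Product using (Σ; ∃; _×_; _,_)
open import Data.Sum using (_⊎_)
open import Relation.Nullary using (¬_)
open import Relation.Binary.Construct.Closure.ReflexiveTransitive using (Star)
open import Data.List.Relation.Binary.Pointwise using (Pointwise)
open import Data.List.Membership.Propositional using (_∈_)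

-- Terms (locally nameless, well-scoped).
-- Free variables are natural numbers (fvar f); bound variables are
-- de Bruijn *levels* (bvar i, i : Fin k, k = number of enclosing binders;
-- level 0 is the outermost binder).  Tm 0 = well-formed terms
-- (every bound variable is bound).

data Tm (k : ℕ) : Set where
  fvar : ℕ → Tm k
  bvar : Fin k → Tm k
  lam  : Tm (suc k) → Tm k
  app  : Tm k → Tm k → Tm k

-- weakening by one extra (innermost) binder; levels are unchanged
wk : ∀ {k} → Tm k → Tm (suc k)
wk (fvar f)  = fvar f
wk (bvar i)  = bvar (inject₁ i)
wk (lam t)   = lam (wk t)
wk (app t s) = app (wk t) (wk s)

-- substitute u for the outermost bound variable (level 0)
subst0 : ∀ {k} → Tm (suc k) → Tm k → Tm k
subst0 (fvar f)       u = fvar f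
subst0 (bvar zero)    u = u
subst0 (bvar (suc i)) u = bvar i
subst0 (lam t)        u = lam (subst0 t (wk u))
subst0 (app t s)      u = app (subst0 t u) (subst0 s u)

_[_] : Tm 1 → Tm 0 → Tm 0
t [ s ] = subst0 t s

data _∈fv_ (f : ℕ) : ∀ {k} → Tm k → Set where
  here  : ∀ {k} → f ∈fv (fvar {k} f)
  inLam : ∀ {k} {t : Tm (suc k)} → f ∈fv t → f ∈fv lam t
  inL   : ∀ {k} {t s : Tm k} → f ∈fv t → f ∈fv app t s
  inR   : ∀ {k} {t s : Tm k} → f ∈fv s → f ∈fv app t s

Term : Set
Term = Tm 0

Stack : Set
Stack = List Term

KConf : Set
KConf = Term × Stack

data _↦K_ : KConf → KConf → Set where
  push : ∀ {t s π} → (app t s , π) ↦K (t , s ∷ π)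
  beta : ∀ {t s π} → (lam t , s ∷ π) ↦K (t [ s ] , π)

_↦K*_ : KConf → KConf → Set
_↦K*_ = Star _↦K_

Symmetric : ∀ {A : Set} → (A → A → Set) → Set
Symmetric {A} R = ∀ {x y : A} → R x y → R y x

liftStack : (Term → Term → Set) → Stack → Stack → Set
liftStack R = Pointwise R

Fresh : ℕ → List Term → Set
Fresh f ts = ∀ {u} → u ∈ ts → ¬ (f ∈fv u)

record IsNFBisim (R : Term → Term → Set) : Set where
  field
    sym  : Symmetric R
    lamC : ∀ {t s} → R t s → ∀ {t′ : Tm 1} →
           (t , []) ↦K* (lam t′ , []) →
           Σ (Tm 1) λ s′ → ((s , []) ↦K* (lam s′ , [])) ×
             Σ ℕ λ f → Fresh f (t ∷ s ∷ lam t′ ∷ lam s′ ∷ []) ×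
               R (t′ [ fvar f ]) (s′ [ fvar f ])
    varC : ∀ {t s} → R t s → ∀ {f π} →
           (t , []) ↦K* (fvar f , π) →
           Σ Stack λ π′ → ((s , []) ↦K* (fvar f , π′)) × liftStack R π π′

_≈nf_ : Term → Term → Set₁
t ≈nf s = Σ (Term → Term → Set) λ R → IsNFBisim R × R t s

data Conf : Set where
  ev   : Term → Stack → ℕ → Conf
  cont : Stack → ℕ → Conf

data Flag : Set where
  lamF  : Flag
  varF  : ℕ → Flag
  doneF : Flag
  enterF : Flag
  skipF : Flag

data _⟶τ_ : Conf → Conf → Set where
  push : ∀ {t s π n} → ev (app t s) π n ⟶τ ev t (s ∷ π) n
  beta : ∀ {t s π n} → ev (lam t) (s ∷ π) n ⟶τ ev (t [ s ]) π n

_⟶τ*_ : Conf → Conf → Set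
_⟶τ*_ = Star _⟶τ_

data _⟶[_]_ : Conf → Flag → Conf → Set where
  lamS   : ∀ {t n} → ev (lam t) [] n ⟶[ lamF ] ev (t [ fvar n ]) [] (suc n)
  varS   : ∀ {f π n} → ev (fvar f) π n ⟶[ varF f ] cont π n
  enterS : ∀ {t π n} → cont (t ∷ π) n ⟶[ enterF ] ev t [] n
  skipS  : ∀ {t π n} → cont (t ∷ π) n ⟶[ skipF ] cont π n

data _⟶[_]∎ : Conf → Flag → Set where
  doneS : ∀ {n} → cont [] n ⟶[ doneF ]∎

record IsMBisim (R : Conf → Conf → Set) : Set where
  field
    sym   : Symmetric R
    step  : ∀ {C₁ C₂} → R C₁ C₂ → ∀ {C₁″ F C₁′} →
            C₁ ⟶τ* C₁″ → C₁″ ⟶[ F ] C₁′ →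
            Σ Conf λ C₂″ → Σ Conf λ C₂′ →
              (C₂ ⟶τ* C₂″) × (C₂″ ⟶[ F ] C₂′) × R C₁′ C₂′
    term  : ∀ {C₁ C₂} → R C₁ C₂ → ∀ {C₁″ F} →
            C₁ ⟶τ* C₁″ → C₁″ ⟶[ F ]∎ →
            Σ Conf λ C₂″ → (C₂ ⟶τ* C₂″) × (C₂″ ⟶[ F ]∎)

_≈m_ : Conf → Conf → Set₁
C₁ ≈m C₂ = Σ (Conf → Conf → Set) λ R → IsMBisim R × R C₁ C₂

{-# OPTIONS --safe #-}
module Submission where

open import Defs
open import Data.Nat using (ℕ; suc; _<_; _≤_; _⊔_; s≤s)
open import Data.Nat.Properties
  using (_≟_; ≤-refl; ≤-trans; <-irrefl; m<n⇒m<1+n; n<1+n; m≤m⊔n; m≤n⊔m)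
open import Data.Product using (Σ; _×_; _,_; proj₁; proj₂)
open import Data.Sum using (_⊎_; inj₁; inj₂; [_,_]′)
open import Data.List using ([]; _∷_; map)
open import Data.List.Relation.Unary.All as All using (All; []; _∷_)
import Data.List.Relation.Unary.All.Properties as AllP
open import Data.List.Relation.Binary.Pointwise as Pointwise using (Pointwise; []; _∷_)
open import Data.Fin using (zero; suc)
open import Data.Empty using (⊥-elim)
open import Function.Base using (id; _∘_)
open import Function.Definitions using (Injective)
open import Function.Bundles using (_⇔_; mk⇔)
open import Relation.Nullary using (¬_; yes; no)
open import Relation.Binary.PropositionalEquality
  using (_≡_; refl; sym; trans; cong; cong₂; subst; subst₂)
open import Relation.Binary.Construct.Closure.ReflexiveTransitive using (ε; _◅_; gmap)

-- (⇐) A machine bisimulation relates ev t [] n and ev s [] n with n above all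
-- free variables; reading off the relation "related for some such n" gives a
-- normal-form bisimulation, the counter n itself serving as the fresh variable.
-- (⇒) The τ-steps of the machine are exactly the KAM steps. A normal-form
-- bisimulation may choose any fresh variable f where the machine uses n, so we
-- first close it under injective renamings and then transpose f and n.

Bounded : ∀ {k} → ℕ → Tm k → Set
Bounded n t = ∀ f → f ∈fv t → f < n

∈fv-wk⁻ : ∀ {k f} (u : Tm k) → f ∈fv wk u → f ∈fv u
∈fv-wk⁻ (fvar _)  here      = here
∈fv-wk⁻ (lam u)   (inLam p) = inLam (∈fv-wk⁻ u p)
∈fv-wk⁻ (app u v) (inL p)   = inL (∈fv-wk⁻ u p)
∈fv-wk⁻ (app u v) (inR p)   = inR (∈fv-wk⁻ v p)

∈fv-subst0⁻ : ∀ {k f} (t : Tm (suc k)) (u : Tm k) → f ∈fv subst0 t u → f ∈fv t ⊎ f ∈fv u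
∈fv-subst0⁻ (fvar _)       u here      = inj₁ here
∈fv-subst0⁻ (bvar zero)    u p         = inj₂ p
∈fv-subst0⁻ (lam t)        u (inLam p) =
  [ inj₁ ∘ inLam , inj₂ ∘ ∈fv-wk⁻ u ]′ (∈fv-subst0⁻ t (wk u) p)
∈fv-subst0⁻ (app t s)      u (inL p)   = [ inj₁ ∘ inL , inj₂ ]′ (∈fv-subst0⁻ t u p)
∈fv-subst0⁻ (app t s)      u (inR p)   = [ inj₁ ∘ inR , inj₂ ]′ (∈fv-subst0⁻ s u p)

bounded-[] : ∀ {n} {t : Tm 1} {s : Term} → Bounded n (lam t) → Bounded n s → Bounded n (t [ s ])
bounded-[] {t = t} {s} bt bs f p = [ bt f ∘ inLam , bs f ]′ (∈fv-subst0⁻ t s p)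

bounded-[fvar] : ∀ {n} {t : Tm 1} → Bounded n (lam t) → Bounded (suc n) (t [ fvar n ])
bounded-[fvar] {n} {t} bt f p with ∈fv-subst0⁻ t (fvar n) p
... | inj₁ q    = m<n⇒m<1+n (bt f (inLam q))
... | inj₂ here = n<1+n n

bounded⇒∉fv : ∀ {k n} {t : Tm k} → Bounded n t → ¬ n ∈fv t
bounded⇒∉fv bt p = <-irrefl refl (bt _ p)

maxfv : ∀ {k} → Tm k → ℕ
maxfv (fvar f)  = f
maxfv (bvar _)  = 0
maxfv (lam t)   = maxfv t
maxfv (app t s) = maxfv t ⊔ maxfv s

∈fv⇒≤maxfv : ∀ {k f} (t : Tm k) → f ∈fv t → f ≤ maxfv t
∈fv⇒≤maxfv (fvar _)  here      = ≤-refl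
∈fv⇒≤maxfv (lam t)   (inLam p) = ∈fv⇒≤maxfv t p
∈fv⇒≤maxfv (app t s) (inL p)   = ≤-trans (∈fv⇒≤maxfv t p) (m≤m⊔n (maxfv t) (maxfv s))
∈fv⇒≤maxfv (app t s) (inR p)   = ≤-trans (∈fv⇒≤maxfv s p) (m≤n⊔m (maxfv t) (maxfv s))

BoundedK : ℕ → KConf → Set
BoundedK n (t , π) = Bounded n t × All (Bounded n) π

↦K-bounded : ∀ {n X Y} → X ↦K Y → BoundedK n X → BoundedK n Y
↦K-bounded push (bt , bπ)        = (λ f → bt f ∘ inL) , (λ f → bt f ∘ inR) ∷ bπ
↦K-bounded beta (bt , (bs ∷ bπ)) = bounded-[] bt bs , bπ

↦K*-bounded : ∀ {n X Y} → X ↦K* Y → BoundedK n X → BoundedK n Y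
↦K*-bounded ε        b = b
↦K*-bounded (r ◅ rs) b = ↦K*-bounded rs (↦K-bounded r b)

↦K*⇒⟶τ* : ∀ {n t π t′ π′} → (t , π) ↦K* (t′ , π′) → ev t π n ⟶τ* ev t′ π′ n
↦K*⇒⟶τ* {n} = gmap (λ (t , π) → ev t π n) λ { push → push ; beta → beta }

⟶τ*⇒↦K* : ∀ {t π n C} → ev t π n ⟶τ* C →
          Σ Term λ t′ → Σ Stack λ π′ → C ≡ ev t′ π′ n × (t , π) ↦K* (t′ , π′)
⟶τ*⇒↦K* {t} {π} ε = t , π , refl , ε
⟶τ*⇒↦K* (push ◅ rs) with ⟶τ*⇒↦K* rs
... | t′ , π′ , e , ks = t′ , π′ , e , push ◅ ks
⟶τ*⇒↦K* (beta ◅ rs) with ⟶τ*⇒↦K* rs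
... | t′ , π′ , e , ks = t′ , π′ , e , beta ◅ ks

ren : ∀ {k} → (ℕ → ℕ) → Tm k → Tm k
ren ρ (fvar f)  = fvar (ρ f)
ren ρ (bvar i)  = bvar i
ren ρ (lam t)   = lam (ren ρ t)
ren ρ (app t s) = app (ren ρ t) (ren ρ s)

renK : (ℕ → ℕ) → KConf → KConf
renK ρ (t , π) = ren ρ t , map (ren ρ) π

ren-wk : ∀ {k} ρ (u : Tm k) → ren ρ (wk u) ≡ wk (ren ρ u)
ren-wk ρ (fvar f)  = refl
ren-wk ρ (bvar i)  = refl
ren-wk ρ (lam u)   = cong lam (ren-wk ρ u)
ren-wk ρ (app u v) = cong₂ app (ren-wk ρ u) (ren-wk ρ v)

ren-subst0 : ∀ {k} ρ (t : Tm (suc k)) (u : Tm k) → ren ρ (subst0 t u) ≡ subst0 (ren ρ t) (ren ρ u)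
ren-subst0 ρ (fvar f)       u = refl
ren-subst0 ρ (bvar zero)    u = refl
ren-subst0 ρ (bvar (suc i)) u = refl
ren-subst0 ρ (lam t)        u =
  cong lam (trans (ren-subst0 ρ t (wk u)) (cong (subst0 (ren ρ t)) (ren-wk ρ u)))
ren-subst0 ρ (app t s)      u = cong₂ app (ren-subst0 ρ t u) (ren-subst0 ρ s u)

ren-∘ : ∀ {k} σ ρ (u : Tm k) → ren σ (ren ρ u) ≡ ren (σ ∘ ρ) u
ren-∘ σ ρ (fvar f)  = refl
ren-∘ σ ρ (bvar i)  = refl
ren-∘ σ ρ (lam u)   = cong lam (ren-∘ σ ρ u)
ren-∘ σ ρ (app u v) = cong₂ app (ren-∘ σ ρ u) (ren-∘ σ ρ v)

ren-fixing-fv : ∀ {k} ρ (u : Tm k) → (∀ g → g ∈fv u → ρ g ≡ g) → ren ρ u ≡ u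
ren-fixing-fv ρ (fvar f)  h = cong fvar (h f here)
ren-fixing-fv ρ (bvar i)  h = refl
ren-fixing-fv ρ (lam u)   h = cong lam (ren-fixing-fv ρ u (λ g → h g ∘ inLam))
ren-fixing-fv ρ (app u v) h =
  cong₂ app (ren-fixing-fv ρ u (λ g → h g ∘ inL)) (ren-fixing-fv ρ v (λ g → h g ∘ inR))

ren-id : ∀ {k} (u : Tm k) → ren id u ≡ u
ren-id u = ren-fixing-fv id u (λ _ _ → refl)

∈fv-ren⁻ : ∀ {k f} ρ (u : Tm k) → f ∈fv ren ρ u → Σ ℕ λ g → g ∈fv u × ρ g ≡ f
∈fv-ren⁻ ρ (fvar g)  here      = g , here , refl
∈fv-ren⁻ ρ (lam u)   (inLam p) with ∈fv-ren⁻ ρ u p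
... | g , q , e = g , inLam q , e
∈fv-ren⁻ ρ (app u v) (inL p)   with ∈fv-ren⁻ ρ u p
... | g , q , e = g , inL q , e
∈fv-ren⁻ ρ (app u v) (inR p)   with ∈fv-ren⁻ ρ v p
... | g , q , e = g , inR q , e

∉fv-ren : ∀ {k f ρ} (u : Tm k) → Injective _≡_ _≡_ ρ → ¬ f ∈fv u → ¬ ρ f ∈fv ren ρ u
∉fv-ren {ρ = ρ} u inj f∉u p with ∈fv-ren⁻ ρ u p
... | g , q , e = f∉u (subst (_∈fv u) (inj e) q)

fresh-ren : ∀ {f ρ ts} → Injective _≡_ _≡_ ρ → Fresh f ts → Fresh (ρ f) (map (ren ρ) ts)
fresh-ren inj fr = All.lookup (AllP.map⁺ (All.map (λ {u} → ∉fv-ren u inj) (All.tabulate fr)))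

↦K-ren : ∀ ρ {X Y} → X ↦K Y → renK ρ X ↦K renK ρ Y
↦K-ren ρ push                  = push
↦K-ren ρ (beta {t} {s} {π}) =
  subst (λ u → (lam (ren ρ t) , ren ρ s ∷ map (ren ρ) π) ↦K (u , map (ren ρ) π))
        (sym (ren-subst0 ρ t s)) beta

↦K*-ren : ∀ ρ {X Y} → X ↦K* Y → renK ρ X ↦K* renK ρ Y
↦K*-ren ρ = gmap (renK ρ) (↦K-ren ρ)

↦K-ren⁻ : ∀ ρ X {Y} → renK ρ X ↦K Y → Σ KConf λ X′ → X ↦K X′ × renK ρ X′ ≡ Y
↦K-ren⁻ ρ (app a b , π)     push = (a , b ∷ π) , push , refl
↦K-ren⁻ ρ (lam b , (s ∷ π)) beta = (b [ s ] , π) , beta , cong (_, map (ren ρ) π) (ren-subst0 ρ b s)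

↦K*-ren⁻ : ∀ ρ X {Y} → renK ρ X ↦K* Y → Σ KConf λ X′ → X ↦K* X′ × renK ρ X′ ≡ Y
↦K*-ren⁻ ρ X ε        = X , ε , refl
↦K*-ren⁻ ρ X (r ◅ rs) with ↦K-ren⁻ ρ X r
... | X₁ , r′ , refl with ↦K*-ren⁻ ρ X₁ rs
... | X′ , rs′ , e = X′ , r′ ◅ rs′ , e

renK-lam⁻ : ∀ ρ X {t′ : Tm 1} → renK ρ X ≡ (lam t′ , []) →
            Σ (Tm 1) λ t₀′ → X ≡ (lam t₀′ , []) × ren ρ t₀′ ≡ t′
renK-lam⁻ ρ (lam b , []) refl = b , refl , refl

renK-fvar⁻ : ∀ ρ X {g π} → renK ρ X ≡ (fvar g , π) →
             Σ ℕ λ f → Σ Stack λ π₀ → X ≡ (fvar f , π₀) × ρ f ≡ g × map (ren ρ) π₀ ≡ π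
renK-fvar⁻ ρ (fvar f , π₀) refl = f , π₀ , refl , refl , refl

swap : ℕ → ℕ → ℕ → ℕ
swap a b x with x ≟ a
... | yes _ = b
... | no _ with x ≟ b
...   | yes _ = a
...   | no _  = x

swap-a : ∀ a b → swap a b a ≡ b
swap-a a b with a ≟ a
... | yes _ = refl
... | no a≢a = ⊥-elim (a≢a refl)

swap-b : ∀ a b → swap a b b ≡ a
swap-b a b with b ≟ a
... | yes b≡a = b≡a
... | no _ with b ≟ b
...   | yes _ = refl
...   | no b≢b = ⊥-elim (b≢b refl)

swap-other : ∀ {a b x} → ¬ x ≡ a → ¬ x ≡ b → swap a b x ≡ x
swap-other {a} {b} {x} x≢a x≢b with x ≟ a
... | yes x≡a = ⊥-elim (x≢a x≡a)
... | no _ with x ≟ b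
...   | yes x≡b = ⊥-elim (x≢b x≡b)
...   | no _ = refl

swap-involutive : ∀ a b x → swap a b (swap a b x) ≡ x
swap-involutive a b x with x ≟ a
... | yes refl = swap-b x b
... | no x≢a with x ≟ b
...   | yes refl = swap-a a x
...   | no x≢b = swap-other x≢a x≢b

swap-injective : ∀ a b → Injective _≡_ _≡_ (swap a b)
swap-injective a b {x} {y} e =
  trans (sym (swap-involutive a b x)) (trans (cong (swap a b) e) (swap-involutive a b y))

swap-[fvar] : ∀ {n f} (u : Tm 1) → Bounded n (lam u) → ¬ f ∈fv lam u →
              ren (swap f n) (u [ fvar f ]) ≡ u [ fvar n ]
swap-[fvar] {n} {f} u bu f∉u =
  trans (ren-subst0 (swap f n) u (fvar f))
        (cong₂ subst0 (ren-fixing-fv (swap f n) u fixed) (cong fvar (swap-a f n)))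
  where
    fixed : ∀ g → g ∈fv u → swap f n g ≡ g
    fixed g p = swap-other (λ { refl → f∉u (inLam p) }) (λ { refl → <-irrefl refl (bu g (inLam p)) })

data Renamed (R : Term → Term → Set) : Term → Term → Set where
  renamed : ∀ {ρ t s} → Injective _≡_ _≡_ ρ → R t s → Renamed R (ren ρ t) (ren ρ s)

Renamed-ren : ∀ {R σ t s} → Injective _≡_ _≡_ σ → Renamed R t s → Renamed R (ren σ t) (ren σ s)
Renamed-ren {σ = σ} injσ (renamed {ρ} {t} {s} injρ r) =
  subst₂ (Renamed _) (sym (ren-∘ σ ρ t)) (sym (ren-∘ σ ρ s)) (renamed (injρ ∘ injσ) r)

Renamed-isNFBisim : ∀ {R} → IsNFBisim R → IsNFBisim (Renamed R)
Renamed-isNFBisim {R} isR = record { sym = symRen ; lamC = lamRen ; varC = varRen }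
  where
    open IsNFBisim isR renaming (sym to symR)

    symRen : Symmetric (Renamed R)
    symRen (renamed inj r) = renamed inj (symR r)

    lamRen : ∀ {t s} → Renamed R t s → ∀ {t′ : Tm 1} → (t , []) ↦K* (lam t′ , []) →
             Σ (Tm 1) λ s′ → ((s , []) ↦K* (lam s′ , [])) ×
               Σ ℕ λ f → Fresh f (t ∷ s ∷ lam t′ ∷ lam s′ ∷ []) ×
                 Renamed R (t′ [ fvar f ]) (s′ [ fvar f ])
    lamRen (renamed {ρ} {t₀} inj r) red with ↦K*-ren⁻ ρ (t₀ , []) red
    ... | X′ , red₀ , e with renK-lam⁻ ρ X′ e
    ... | t₀′ , refl , refl with lamC r red₀
    ... | s₀′ , red′ , f , fr , r′ =
      ren ρ s₀′ , ↦K*-ren ρ red′ , ρ f , fresh-ren inj fr ,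
      subst₂ (Renamed R) (ren-subst0 ρ t₀′ (fvar f)) (ren-subst0 ρ s₀′ (fvar f)) (renamed inj r′)

    varRen : ∀ {t s} → Renamed R t s → ∀ {f π} → (t , []) ↦K* (fvar f , π) →
             Σ Stack λ π′ → ((s , []) ↦K* (fvar f , π′)) × liftStack (Renamed R) π π′
    varRen (renamed {ρ} {t₀} inj r) red with ↦K*-ren⁻ ρ (t₀ , []) red
    ... | X′ , red₀ , e with renK-fvar⁻ ρ X′ e
    ... | f₀ , π₀ , refl , refl , refl with varC r red₀
    ... | π₀′ , red′ , rπ = map (ren ρ) π₀′ , ↦K*-ren ρ red′ ,
                            Pointwise.map⁺ _ _ (Pointwise.map (renamed inj) rπ)

module FromNFBisim {R : Term → Term → Set} (isR : IsNFBisim R)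
    (ren-closed : ∀ {σ t s} → Injective _≡_ _≡_ σ → R t s → R (ren σ t) (ren σ s)) where

  open IsNFBisim isR renaming (sym to symR)

  data MachineRel : Conf → Conf → Set where
    evR   : ∀ {t s n} → R t s → Bounded n t → Bounded n s → MachineRel (ev t [] n) (ev s [] n)
    contR : ∀ {π π′ n} → Pointwise R π π′ → All (Bounded n) π → All (Bounded n) π′ →
            MachineRel (cont π n) (cont π′ n)

  symMachineRel : Symmetric MachineRel
  symMachineRel (evR r bt bs)      = evR (symR r) bs bt
  symMachineRel (contR rπ bπ bπ′) = contR (Pointwise.symmetric symR rπ) bπ′ bπ

  MatchedBy : Conf → Flag → Conf → Set
  MatchedBy C₂ F C₁′ = Σ Conf λ C₂″ → Σ Conf λ C₂′ → C₂ ⟶τ* C₂″ × C₂″ ⟶[ F ] C₂′ × MachineRel C₁′ C₂′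

  stepEv : ∀ {t s n u π F C₁′} → R t s → Bounded n t → Bounded n s →
           (t , []) ↦K* (u , π) → ev u π n ⟶[ F ] C₁′ → MatchedBy (ev s [] n) F C₁′
  stepEv {n = n} r bt bs red (lamS {t′}) with lamC r red
  ... | s′ , red′ , f , fr , r′ with All.tabulate fr
  ... | _ ∷ _ ∷ f∉t′ ∷ f∉s′ ∷ [] =
    _ , _ , ↦K*⇒⟶τ* red′ , lamS ,
    evR (subst₂ R (swap-[fvar] t′ bt′ f∉t′) (swap-[fvar] s′ bs′ f∉s′)
                  (ren-closed (swap-injective f n) r′))
        (bounded-[fvar] bt′) (bounded-[fvar] bs′)
    where
      bt′ = proj₁ (↦K*-bounded red (bt , []))
      bs′ = proj₁ (↦K*-bounded red′ (bs , []))
  stepEv r bt bs red varS with varC r red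
  ... | π′ , red′ , rπ =
    _ , _ , ↦K*⇒⟶τ* red′ , varS ,
    contR rπ (proj₂ (↦K*-bounded red (bt , []))) (proj₂ (↦K*-bounded red′ (bs , [])))

  stepMachineRel : ∀ {C₁ C₂} → MachineRel C₁ C₂ → ∀ {C₁″ F C₁′} →
           C₁ ⟶τ* C₁″ → C₁″ ⟶[ F ] C₁′ → MatchedBy C₂ F C₁′
  stepMachineRel (evR r bt bs) τs fl with ⟶τ*⇒↦K* τs
  ... | _ , _ , refl , red = stepEv r bt bs red fl
  stepMachineRel (contR (r ∷ rπ) (b ∷ bπ) (b′ ∷ bπ′)) ε enterS = _ , _ , ε , enterS , evR r b b′
  stepMachineRel (contR (r ∷ rπ) (b ∷ bπ) (b′ ∷ bπ′)) ε skipS  = _ , _ , ε , skipS , contR rπ bπ bπ′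

  termMachineRel : ∀ {C₁ C₂} → MachineRel C₁ C₂ → ∀ {C₁″ F} → C₁ ⟶τ* C₁″ → C₁″ ⟶[ F ]∎ →
           Σ Conf λ C₂″ → C₂ ⟶τ* C₂″ × C₂″ ⟶[ F ]∎
  termMachineRel (evR r bt bs) τs d with ⟶τ*⇒↦K* τs
  termMachineRel (evR r bt bs) τs () | _ , _ , refl , _
  termMachineRel (contR [] _ _) ε doneS = _ , ε , doneS

  isMBisim : IsMBisim MachineRel
  isMBisim = record { sym = symMachineRel ; step = stepMachineRel ; term = termMachineRel }

module FromMBisim {M : Conf → Conf → Set} (isM : IsMBisim M) where

  open IsMBisim isM renaming (sym to symM)

  TermRel : Term → Term → Set
  TermRel t s = Σ ℕ λ n → Bounded n t × Bounded n s × M (ev t [] n) (ev s [] n)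

  symTermRel : Symmetric TermRel
  symTermRel (n , bt , bs , r) = n , bs , bt , symM r

  lamS⁻ : ∀ {n u π C} → ev u π n ⟶[ lamF ] C →
          Σ (Tm 1) λ u′ → u ≡ lam u′ × π ≡ [] × C ≡ ev (u′ [ fvar n ]) [] (suc n)
  lamS⁻ lamS = _ , refl , refl , refl

  varS⁻ : ∀ {f n u π C} → ev u π n ⟶[ varF f ] C → u ≡ fvar f × C ≡ cont π n
  varS⁻ varS = refl , refl

  lamTermRel : ∀ {t s} → TermRel t s → ∀ {t′ : Tm 1} → (t , []) ↦K* (lam t′ , []) →
          Σ (Tm 1) λ s′ → ((s , []) ↦K* (lam s′ , [])) ×
            Σ ℕ λ f → Fresh f (t ∷ s ∷ lam t′ ∷ lam s′ ∷ []) × TermRel (t′ [ fvar f ]) (s′ [ fvar f ])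
  lamTermRel (n , bt , bs , r) red with step r (↦K*⇒⟶τ* red) lamS
  ... | _ , _ , τs , fl , r′ with ⟶τ*⇒↦K* τs
  ... | _ , _ , refl , red′ with lamS⁻ fl
  ... | s′ , refl , refl , refl =
    s′ , red′ , n ,
    All.lookup (bounded⇒∉fv bt ∷ bounded⇒∉fv bs ∷ bounded⇒∉fv bt′ ∷ bounded⇒∉fv bs′ ∷ []) ,
    (suc n , bounded-[fvar] bt′ , bounded-[fvar] bs′ , r′)
    where
      bt′ = proj₁ (↦K*-bounded red (bt , []))
      bs′ = proj₁ (↦K*-bounded red′ (bs , []))

  -- In a cont configuration no τ-step is possible, so the first element can
  -- only be matched by enter and the rest of the stack by skip.
  cont⇒Pointwise : ∀ {n π π′} → All (Bounded n) π → All (Bounded n) π′ →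
                   M (cont π n) (cont π′ n) → Pointwise TermRel π π′
  cont⇒Pointwise {π = []} _ _ r with term r ε doneS
  ... | _ , ε , doneS = []
  cont⇒Pointwise {π = _ ∷ _} (b ∷ bπ) bπ′ r with step r ε enterS | step r ε skipS
  cont⇒Pointwise (b ∷ bπ) (b′ ∷ bπ′) r | _ , _ , ε , enterS , rₑ | _ , _ , ε , skipS , rₛ =
    (_ , b , b′ , rₑ) ∷ cont⇒Pointwise bπ bπ′ rₛ

  varTermRel : ∀ {t s} → TermRel t s → ∀ {f π} → (t , []) ↦K* (fvar f , π) →
          Σ Stack λ π′ → ((s , []) ↦K* (fvar f , π′)) × liftStack TermRel π π′
  varTermRel (n , bt , bs , r) red with step r (↦K*⇒⟶τ* red) varS
  ... | _ , _ , τs , fl , r′ with ⟶τ*⇒↦K* τs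
  ... | _ , π′ , refl , red′ with varS⁻ fl
  ... | refl , refl =
    π′ , red′ ,
    cont⇒Pointwise (proj₂ (↦K*-bounded red (bt , []))) (proj₂ (↦K*-bounded red′ (bs , []))) r′

  isNFBisim : IsNFBisim TermRel
  isNFBisim = record { sym = symTermRel ; lamC = lamTermRel ; varC = varTermRel }


theorem4p5 : (t s : Term) →
    t ≈nf s ⇔ Σ ℕ (λ n → (∀ f → (f ∈fv t ⊎ f ∈fv s) → f < n) × (ev t [] n ≈m ev s [] n))
theorem4p5 t s = mk⇔ to from
  where
    to : t ≈nf s → Σ ℕ (λ n → (∀ f → (f ∈fv t ⊎ f ∈fv s) → f < n) × (ev t [] n ≈m ev s [] n))
    to (R , isR , r) = n , (λ f → [ bt f , bs f ]′) , MachineRel , isMBisim , evR rₜₛ bt bs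
      where
        open FromNFBisim (Renamed-isNFBisim isR) Renamed-ren
        n = suc (maxfv t ⊔ maxfv s)
        bt : Bounded n t
        bt f p = s≤s (≤-trans (∈fv⇒≤maxfv t p) (m≤m⊔n (maxfv t) (maxfv s)))
        bs : Bounded n s
        bs f p = s≤s (≤-trans (∈fv⇒≤maxfv s p) (m≤n⊔m (maxfv t) (maxfv s)))
        rₜₛ : Renamed R t s
        rₜₛ = subst₂ (Renamed R) (ren-id t) (ren-id s) (renamed id r)
    from : Σ ℕ (λ n → (∀ f → (f ∈fv t ⊎ f ∈fv s) → f < n) × (ev t [] n ≈m ev s [] n)) → t ≈nf s
    from (n , b , M , isM , r) = TermRel , isNFBisim , n , (λ f → b f ∘ inj₁) , (λ f → b f ∘ inj₂) , r
      where open FromMBisim isM
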